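{- Let $\Delta\in\mathbb{Z}_{\ge2}$, let $\boldsymbol{\lambda}=(\lambda_i)_{i=1}^m$ be a partition of $\Delta-1$, and let $r$ be a positive integer with $r\ge m+1$. Then the matrix $\mathbf{A}(\Delta,\boldsymbol{\lambda},r)$ is $\Delta$-modular.
   Context: A partition of $n$ is a non-increasing sequence of positive integers summing to $n$. $\mathbf{A}(\Delta,\boldsymbol{\lambda},r)$ is the integer matrix with $r$ rows whose columns are: $\mathbf{e}_i$ for all $i\in[r]$; $\mathbf{e}_i-\mathbf{e}_j$ for all $1\le i<j\le r$; $k\mathbf{e}_1+\mathbf{e}_{i+1}$ for all $i\in[m]$, $k\in[\lambda_i]$; and $k\mathbf{e}_1+\mathbf{e}_{i+1}-\mathbf{e}_j$ for all $i\in[m]$, $k\in[\lambda_i]$, $j\in[r]-\{1,i+1\}$. An integer matrix $\mathbf{A}$ is $\Delta$-modular if every $\operatorname{rank}(\mathbf{A})\times\operatorname{rank}(\mathbf{A})$ submatrix has determinant of absolute value at most $\Delta$. -}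

module Defs where

open import Data.Nat as ℕ using (ℕ; zero; suc; _≤_; _≥_)
open import Data.Integer as ℤ using (ℤ; +_; _-_; _*_; ∣_∣)
open import Data.Fin using (Fin; zero; suc; toℕ; punchIn)
open import Data.List using (List; []; _∷_; _++_; map; concatMap; upTo; length; lookup; zip)
open import Data.Nat.ListAction using (sum)
open import Data.List.Relation.Unary.All using (All)
open import Data.List.Relation.Unary.Linked using (Linked)
open import Data.Bool using (if_then_else_)
open import Data.Product using (Σ; ∃; _×_; _,_)
open import Relation.Nullary using (¬_)
open import Relation.Nullary.Decidable using (⌊_⌋)
open import Relation.Binary.PropositionalEquality using (_≡_)
open import Function.Definitions using (Injective)

Mat : ℕ → ℕ → Set
Mat r c = Fin r → Fin c → ℤ

sumFin : (n : ℕ) → (Fin n → ℤ) → ℤ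
sumFin zero    f = + 0
sumFin (suc n) f = f zero ℤ.+ sumFin n (λ i → f (suc i))

sign : ℕ → ℤ
sign zero          = + 1
sign (suc zero)    = ℤ.- (+ 1)
sign (suc (suc n)) = sign n

det : (n : ℕ) → Mat n n → ℤ
det zero    M = + 1
det (suc n) M =
  sumFin (suc n) (λ j → sign (toℕ j) * M zero j * det n (λ a b → M (suc a) (punchIn j b)))

Sub : ∀ {r c k} → Mat r c → (Fin k → Fin r) → (Fin k → Fin c) → Mat k k
Sub A ρ γ a b = A (ρ a) (γ b)

record Minor (r c k : ℕ) : Set where
  field
    rows    : Fin k → Fin r
    cols    : Fin k → Fin c
    rowsInj : Injective _≡_ _≡_ rows
    colsInj : Injective _≡_ _≡_ cols

minorDet : ∀ {r c k} → Mat r c → Minor r c k → ℤ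
minorDet {k = k} A μ = det k (Sub A (Minor.rows μ) (Minor.cols μ))

HasRank : ∀ {r c} → Mat r c → ℕ → Set
HasRank {r} {c} A k =
  (∃ λ (μ : Minor r c k) → ¬ (minorDet A μ ≡ + 0)) ×
  (∀ (μ : Minor r c (suc k)) → minorDet A μ ≡ + 0)

IsModular : ∀ {r c} → ℕ → Mat r c → Set
IsModular {r} {c} Δ A =
  ∀ k → HasRank A k → ∀ (μ : Minor r c k) → ∣ minorDet A μ ∣ ≤ Δ

IsPartition : ℕ → List ℕ → Set
IsPartition n λs = All (λ x → 1 ≤ x) λs × Linked _≥_ λs × sum λs ≡ n

range1 : ℕ → List ℕ
range1 n = map suc (upTo n)

-- standard unit vector e_i in ℤ^r, with 1-based index i
e : (r : ℕ) → ℕ → Fin r → ℤ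
e r i t = if ⌊ suc (toℕ t) ℕ.≟ i ⌋ then + 1 else + 0

infixl 6 _⊕_ _⊖_
_⊕_ _⊖_ : ∀ {r} → (Fin r → ℤ) → (Fin r → ℤ) → Fin r → ℤ
(u ⊕ v) t = u t ℤ.+ v t
(u ⊖ v) t = u t - v t

_·_ : ∀ {r} → ℕ → (Fin r → ℤ) → Fin r → ℤ
(k · v) t = + k * v t

-- list of columns of A(Δ, λ, r)  (Δ only enters through λ being a partition of Δ-1)
columnsA : List ℕ → (r : ℕ) → List (Fin r → ℤ)
columnsA λs r =
     map (e r) (range1 r)
  ++ concatMap (λ i → concatMap (λ j → if ⌊ i ℕ.<? j ⌋ then (e r i ⊖ e r j) ∷ [] else []) (range1 r)) (range1 r)
  ++ concatMap (λ { (i , li) → map (λ k → k · e r 1 ⊕ e r (suc i)) (range1 li) })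
               (zip (range1 (length λs)) λs)
  ++ concatMap (λ { (i , li) → concatMap (λ k →
                    concatMap (λ j → if ⌊ j ℕ.≟ 1 ⌋ then []
                                     else if ⌊ j ℕ.≟ suc i ⌋ then []
                                     else (k · e r 1 ⊕ e r (suc i) ⊖ e r j) ∷ [])
                              (range1 r)) (range1 li) })
               (zip (range1 (length λs)) λs)

matA : (Δ : ℕ) → (λs : List ℕ) → (r : ℕ) → Mat r (length (columnsA λs r))
matA Δ λs r t j = lookup (columnsA λs r) j t

{-# OPTIONS --safe #-}
module Submission where

-- Call a vector an incidence vector if its entries lie in {0, 1, -1}, with at most one 1 and at
-- most one -1. Square matrices of incidence vectors have determinant 0 or ±1 (pivot on a nonzero
-- entry of the first row). Every column of A(Δ, λ, r) is an incidence vector or k e₁ + w with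
-- k ≤ λᵢ and w an incidence vector vanishing in row 1 with its 1 in row i + 1. A square submatrix
-- avoiding row 1 thus has |det| ≤ 1. Otherwise expand its first row linearly: the contribution of
-- the incidence columns is ≤ 1 in absolute value, and for each i the contribution of the columns
-- k e₁ + w lifted at i is a row with entries in {0, …, λᵢ}, a sum of λᵢ rows of 0s and 1s. Each
-- of these has |det| ≤ 1 because subtracting columns that share their 1 in row i + 1 gives
-- incidence vectors again. Hence every minor is at most 1 + Σ λᵢ = Δ.

open import Defs
open import Data.Nat using (ℕ; _≤_; suc; _∸_)
open import Data.List using (List; length)

open import Data.Bool using (if_then_else_)
open import Data.Empty using (⊥-elim)
open import Data.Fin as Fin using (Fin; zero; suc; toℕ; punchIn; punchOut)
open import Data.Fin.Permutation as Perm using ()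
open import Data.Fin.Permutation.Components using (transpose)
open import Data.Fin.Properties
  using ( _≟_; suc-injective; toℕ-injective; toℕ-inject₁; toℕ-inject≤; toℕ<n; toℕ-fromℕ<
        ; any?; all?; ¬∀⟶∃¬; punchIn-injective; punchInᵢ≢i; punchIn-punchOut)
open import Data.Integer as ℤ using (ℤ; +_; -_; _+_; _*_; _-_; ∣_∣; 0ℤ; 1ℤ; -1ℤ)
import Data.Integer.Properties as ℤP
open import Data.Integer.Tactic.RingSolver using (solve-∀)
open import Data.List as List using ([]; _∷_; map; zip; applyUpTo; concatMap)
open import Data.List.Membership.Propositional.Properties using (∈-lookup)
open import Data.List.Relation.Unary.All as All using (All; []; _∷_)
open import Data.List.Relation.Unary.All.Properties using (++⁺; map⁺; concat⁺; applyUpTo⁺₁)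
open import Data.Nat as ℕ using (zero; z≤n; s≤s; _⊓_)
import Data.Nat.Properties as ℕP
open import Data.Nat.ListAction using () renaming (sum to sumList)
open import Data.Product using (∃; ∃₂; _×_; _,_; proj₁; proj₂)
open import Data.Sum using (_⊎_; inj₁; inj₂)
open import Data.Vec.Functional using (removeAt; updateAt)
open import Data.Vec.Functional.Properties using (updateAt-updates; updateAt-minimal)
open import Function using (_∘_; const; id)
open import Function.Definitions using (Injective)
open import Relation.Binary.Definitions using (tri<; tri≈; tri>)
open import Relation.Binary.PropositionalEquality
open import Relation.Nullary using (Dec; yes; no)
open import Relation.Nullary.Decidable using (⌊_⌋; dec-true; dec-false)

open import Algebra.Properties.Semiring.Sum ℕP.+-*-semiring using () renaming (sum to sumℕ)
open import Algebra.Properties.Semiring.Sum ℤP.+-*-semiring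
  using (sum; sum-cong-≗; ∑-distrib-+; *-distribˡ-sum; sum-remove; sum-permute; sum-replicate-zero)

sumFin≡sum : ∀ n (f : Fin n → ℤ) → sumFin n f ≡ sum f
sumFin≡sum zero    f = refl
sumFin≡sum (suc n) f = cong (_+_ (f zero)) (sumFin≡sum n (f ∘ suc))

sum-linear : ∀ {n} α β (f g : Fin n → ℤ) →
             sum (λ j → α * f j + β * g j) ≡ α * sum f + β * sum g
sum-linear α β f g = trans (∑-distrib-+ (λ j → α * f j) (λ j → β * g j))
  (sym (cong₂ _+_ (*-distribˡ-sum α f) (*-distribˡ-sum β g)))

sum-neg : ∀ {n} (f : Fin n → ℤ) → sum (λ j → - f j) ≡ - sum f
sum-neg f = begin
  sum (λ j → - f j)       ≡⟨ sum-cong-≗ (λ j → sym (ℤP.-1*i≡-i (f j))) ⟩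
  sum (λ j → -1ℤ * f j)   ≡⟨ sym (*-distribˡ-sum -1ℤ f) ⟩
  -1ℤ * sum f             ≡⟨ ℤP.-1*i≡-i (sum f) ⟩
  - sum f                 ∎
  where open ≡-Reasoning

sum-single : ∀ {n} (f : Fin n → ℤ) p → (∀ b → b ≢ p → f b ≡ 0ℤ) → sum f ≡ f p
sum-single {suc n} f p off-p = begin
  sum f                      ≡⟨ sum-remove {i = p} f ⟩
  f p + sum (removeAt f p)   ≡⟨ cong (_+_ (f p)) (sum-cong-≗ (λ b → off-p _ (punchInᵢ≢i p b))) ⟩
  f p + sum {n} (λ _ → 0ℤ)   ≡⟨ cong (_+_ (f p)) (sum-replicate-zero n) ⟩
  f p + 0ℤ                   ≡⟨ ℤP.+-identityʳ (f p) ⟩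
  f p                        ∎
  where open ≡-Reasoning

i≡-i⇒i≡0 : ∀ {i : ℤ} → i ≡ - i → i ≡ 0ℤ
i≡-i⇒i≡0 {i} i≡-i = ℤP.*-cancelˡ-≡ (+ 2) i 0ℤ (begin
  + 2 * i   ≡⟨ double i ⟩
  i + i     ≡⟨ cong (_+_ i) i≡-i ⟩
  i - i     ≡⟨ ℤP.+-inverseʳ i ⟩
  0ℤ        ∎)
  where
  open ≡-Reasoning
  double : ∀ x → + 2 * x ≡ x + x
  double = solve-∀

sign-suc : ∀ k → sign (suc k) ≡ - sign k
sign-suc zero          = refl
sign-suc (suc zero)    = refl
sign-suc (suc (suc k)) = sign-suc k

∣sign∣ : ∀ k → ∣ sign k ∣ ≡ 1
∣sign∣ zero          = refl
∣sign∣ (suc zero)    = refl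
∣sign∣ (suc (suc k)) = ∣sign∣ k

punchIn≢ : ∀ {n} {j q : Fin (suc n)} (j≢q : j ≢ q) {b} → b ≢ punchOut j≢q → punchIn j b ≢ q
punchIn≢ {j = j} j≢q {b} b≢ eq =
  b≢ (punchIn-injective j b _ (trans eq (sym (punchIn-punchOut j≢q))))

transpose-matchˡ : ∀ {n} (i j : Fin n) → transpose i j i ≡ j
transpose-matchˡ i j rewrite dec-true (i ≟ i) refl = refl

transpose-matchʳ : ∀ {n} (i j : Fin n) → transpose i j j ≡ i
transpose-matchʳ i j with j ≟ i
... | yes refl = refl
... | no j≢i rewrite dec-true (j ≟ j) refl = refl

transpose-other : ∀ {n} {i j k : Fin n} → k ≢ i → k ≢ j → transpose i j k ≡ k
transpose-other {i = i} {j} {k} k≢i k≢j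
  rewrite dec-false (k ≟ i) k≢i | dec-false (k ≟ j) k≢j = refl

Adjacent : ∀ {n} → Fin n → Fin n → Set
Adjacent p q = toℕ q ≡ suc (toℕ p)

adjacent-punchOut : ∀ {n} (j p q : Fin (suc n)) → Adjacent p q → j ≢ p → j ≢ q →
                    ∃₂ λ p′ q′ → punchIn j p′ ≡ p × punchIn j q′ ≡ q × Adjacent p′ q′
adjacent-punchOut zero zero q adj j≢p j≢q = ⊥-elim (j≢p refl)
adjacent-punchOut zero (suc p) (suc q) adj j≢p j≢q = p , q , refl , refl , ℕP.suc-injective adj
adjacent-punchOut {suc n} (suc zero) zero (suc zero) adj j≢p j≢q = ⊥-elim (j≢q refl)
adjacent-punchOut {suc (suc n)} (suc (suc j)) zero (suc zero) adj j≢p j≢q =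
  zero , suc zero , refl , refl , refl
adjacent-punchOut {suc n} (suc j) (suc p) (suc q) adj j≢p j≢q
  with adjacent-punchOut j p q (ℕP.suc-injective adj) (j≢p ∘ cong suc) (j≢q ∘ cong suc)
... | p′ , q′ , p≡ , q≡ , adj′ = suc p′ , suc q′ , cong suc p≡ , cong suc q≡ , cong suc adj′

adjacent-punchIn : ∀ {n} (p q : Fin (suc n)) → Adjacent p q → ∀ b →
                   punchIn p b ≡ punchIn q b ⊎ (punchIn p b ≡ q × punchIn q b ≡ p)
adjacent-punchIn zero (suc zero) adj zero    = inj₂ (refl , refl)
adjacent-punchIn zero (suc zero) adj (suc b) = inj₁ refl
adjacent-punchIn {suc n} (suc p) (suc q) adj zero = inj₁ refl
adjacent-punchIn {suc n} (suc p) (suc q) adj (suc b)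
  with adjacent-punchIn p q (ℕP.suc-injective adj) b
... | inj₁ eq         = inj₁ (cong suc eq)
... | inj₂ (eq , eq′) = inj₂ (cong suc eq , cong suc eq′)

module _ {n} {p q : Fin (suc n)} (adj : Adjacent p q) where

  transpose-punchInˡ : ∀ b → transpose p q (punchIn p b) ≡ punchIn q b
  transpose-punchInˡ b with adjacent-punchIn p q adj b
  ... | inj₁ eq = trans (transpose-other (punchInᵢ≢i p b) (λ e → punchInᵢ≢i q b (trans (sym eq) e))) eq
  ... | inj₂ (eq , eq′) = trans (cong (transpose p q) eq) (trans (transpose-matchʳ p q) (sym eq′))

  transpose-punchInʳ : ∀ b → transpose p q (punchIn q b) ≡ punchIn p b
  transpose-punchInʳ b with adjacent-punchIn p q adj b
  ... | inj₁ eq = trans (transpose-other (λ e → punchInᵢ≢i p b (trans eq e)) (punchInᵢ≢i q b)) (sym eq)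
  ... | inj₂ (eq , eq′) = trans (cong (transpose p q) eq′) (trans (transpose-matchˡ p q) (sym eq))

punchIn-transpose : ∀ {n} (j : Fin (suc n)) (p′ q′ b : Fin n) → Dec (b ≡ p′) → Dec (b ≡ q′) →
                    punchIn j (transpose p′ q′ b) ≡ transpose (punchIn j p′) (punchIn j q′) (punchIn j b)
punchIn-transpose j p′ q′ .p′ (yes refl) _ =
  trans (cong (punchIn j) (transpose-matchˡ p′ q′)) (sym (transpose-matchˡ (punchIn j p′) (punchIn j q′)))
punchIn-transpose j p′ q′ .q′ (no _) (yes refl) =
  trans (cong (punchIn j) (transpose-matchʳ p′ q′)) (sym (transpose-matchʳ (punchIn j p′) (punchIn j q′)))
punchIn-transpose j p′ q′ b (no b≢p′) (no b≢q′) =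
  trans (cong (punchIn j) (transpose-other b≢p′ b≢q′))
        (sym (transpose-other (b≢p′ ∘ punchIn-injective j b p′) (b≢q′ ∘ punchIn-injective j b q′)))

updateAt-∘ : ∀ {k n} {v : Fin n → ℤ} {ρ : Fin k → Fin n} → Injective _≡_ _≡_ ρ →
             ∀ s f a → updateAt (v ∘ ρ) s f a ≡ updateAt v (ρ s) f (ρ a)
updateAt-∘ {v = v} {ρ} ρ-inj s f a with a ≟ s
... | yes refl = trans (updateAt-updates a (v ∘ ρ)) (sym (updateAt-updates (ρ a) v))
... | no a≢s   = trans (updateAt-minimal a s (v ∘ ρ) a≢s)
                       (sym (updateAt-minimal (ρ a) (ρ s) v (a≢s ∘ ρ-inj)))

-- Determinants

minor₀ : ∀ {n} → Mat (suc n) (suc n) → Fin (suc n) → Mat n n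
minor₀ M j a b = M (suc a) (punchIn j b)

laplaceTerm : ∀ {n} → Mat (suc n) (suc n) → Fin (suc n) → ℤ
laplaceTerm {n} M j = sign (toℕ j) * M zero j * det n (minor₀ M j)

det-laplace : ∀ {n} (M : Mat (suc n) (suc n)) → det (suc n) M ≡ sum (laplaceTerm M)
det-laplace {n} M = sumFin≡sum (suc n) (laplaceTerm M)

det-by-terms : ∀ {n} (M : Mat (suc n) (suc n)) {f : Fin (suc n) → ℤ} →
               (∀ j → laplaceTerm M j ≡ f j) → det (suc n) M ≡ sum f
det-by-terms M terms = trans (det-laplace M) (sum-cong-≗ terms)

det-cong : ∀ n {M N : Mat n n} → (∀ a b → M a b ≡ N a b) → det n M ≡ det n N
det-cong zero    M≗N = refl
det-cong (suc n) {M} {N} M≗N = trans (det-by-terms M term) (sym (det-laplace N))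
  where
  term : ∀ j → laplaceTerm M j ≡ laplaceTerm N j
  term j = cong₂ (λ x y → sign (toℕ j) * x * y)
                 (M≗N zero j) (det-cong n (λ a b → M≗N (suc a) (punchIn j b)))

laplaceTerm-zero : ∀ {n} (M : Mat (suc n) (suc n)) j → M zero j ≡ 0ℤ → laplaceTerm M j ≡ 0ℤ
laplaceTerm-zero {n} M j M0j≡0 = begin
  sign (toℕ j) * M zero j * det n (minor₀ M j)  ≡⟨ cong (λ m → sign (toℕ j) * m * det n (minor₀ M j)) M0j≡0 ⟩
  sign (toℕ j) * 0ℤ * det n (minor₀ M j)        ≡⟨ cong (_* det n (minor₀ M j)) (ℤP.*-zeroʳ (sign (toℕ j))) ⟩
  0ℤ * det n (minor₀ M j)                       ≡⟨ ℤP.*-zeroˡ (det n (minor₀ M j)) ⟩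
  0ℤ                                            ∎
  where open ≡-Reasoning

∣laplaceTerm∣ : ∀ {n} (M : Mat (suc n) (suc n)) j →
                ∣ laplaceTerm M j ∣ ≡ ∣ M zero j ∣ ℕ.* ∣ det n (minor₀ M j) ∣
∣laplaceTerm∣ {n} M j = begin
  ∣ sign (toℕ j) * M zero j * d ∣               ≡⟨ ℤP.∣i*j∣≡∣i∣*∣j∣ (sign (toℕ j) * M zero j) d ⟩
  ∣ sign (toℕ j) * M zero j ∣ ℕ.* ∣ d ∣         ≡⟨ cong (ℕ._* ∣ d ∣) (ℤP.∣i*j∣≡∣i∣*∣j∣ (sign (toℕ j)) (M zero j)) ⟩
  ∣ sign (toℕ j) ∣ ℕ.* ∣ M zero j ∣ ℕ.* ∣ d ∣   ≡⟨ cong (λ k → k ℕ.* ∣ M zero j ∣ ℕ.* ∣ d ∣) (∣sign∣ (toℕ j)) ⟩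
  1 ℕ.* ∣ M zero j ∣ ℕ.* ∣ d ∣                  ≡⟨ cong (ℕ._* ∣ d ∣) (ℕP.*-identityˡ ∣ M zero j ∣) ⟩
  ∣ M zero j ∣ ℕ.* ∣ d ∣                        ∎
  where
  open ≡-Reasoning
  d = det n (minor₀ M j)

det-zero-row : ∀ n (M : Mat n n) x → (∀ b → M x b ≡ 0ℤ) → det n M ≡ 0ℤ
det-zero-row (suc n) M zero zero-row =
  trans (det-by-terms M (λ j → laplaceTerm-zero M j (zero-row j))) (sum-replicate-zero (suc n))
det-zero-row (suc n) M (suc x) zero-row = trans (det-by-terms M term) (sum-replicate-zero (suc n))
  where
  term : ∀ j → laplaceTerm M j ≡ 0ℤ
  term j = trans (cong (sign (toℕ j) * M zero j *_)
                       (det-zero-row n (minor₀ M j) x (λ b → zero-row (punchIn j b))))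
                 (ℤP.*-zeroʳ (sign (toℕ j) * M zero j))

det-single-entry : ∀ n (M : Mat (suc n) (suc n)) p → (∀ b → b ≢ p → M zero b ≡ 0ℤ) →
                   det (suc n) M ≡ laplaceTerm M p
det-single-entry n M p off-p =
  trans (det-laplace M) (sum-single (laplaceTerm M) p (λ b b≢p → laplaceTerm-zero M b (off-p b b≢p)))

det-linear-column : ∀ n {M N P : Mat n n} q α β →
              (∀ a b → b ≢ q → M a b ≡ P a b) → (∀ a b → b ≢ q → N a b ≡ P a b) →
              (∀ a → P a q ≡ α * M a q + β * N a q) → det n P ≡ α * det n M + β * det n N
det-linear-column (suc n) {M} {N} {P} q α β M≈P N≈P Pq =
  trans (det-by-terms P term)
    (trans (sum-linear α β (laplaceTerm M) (laplaceTerm N))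
      (sym (cong₂ (λ x y → α * x + β * y) (det-laplace M) (det-laplace N))))
  where
  term : ∀ j → laplaceTerm P j ≡ α * laplaceTerm M j + β * laplaceTerm N j
  term j with j ≟ q
  ... | yes refl = begin
    s * P zero j * dP                            ≡⟨ cong (λ x → s * x * dP) (Pq zero) ⟩
    s * (α * M zero j + β * N zero j) * dP       ≡⟨ distrib s α β (M zero j) (N zero j) dP ⟩
    α * (s * M zero j * dP) + β * (s * N zero j * dP)
      ≡⟨ sym (cong₂ (λ x y → α * (s * M zero j * x) + β * (s * N zero j * y))
                    (minor≡ M≈P) (minor≡ N≈P)) ⟩
    α * laplaceTerm M j + β * laplaceTerm N j    ∎
    where
    open ≡-Reasoning
    s = sign (toℕ j)
    dP = det n (minor₀ P j)
    minor≡ : ∀ {K : Mat (suc n) (suc n)} → (∀ a b → b ≢ q → K a b ≡ P a b) →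
             det n (minor₀ K j) ≡ dP
    minor≡ K≈P = det-cong n (λ a b → K≈P (suc a) (punchIn j b) (punchInᵢ≢i j b))
    distrib : ∀ s α β m n d → s * (α * m + β * n) * d ≡ α * (s * m * d) + β * (s * n * d)
    distrib = solve-∀
  ... | no j≢q = begin
    s * P zero j * det n (minor₀ P j)                  ≡⟨ cong (s * P zero j *_) ih ⟩
    s * P zero j * (α * dM + β * dN)                   ≡⟨ distrib s (P zero j) α β dM dN ⟩
    α * (s * P zero j * dM) + β * (s * P zero j * dN)
      ≡⟨ sym (cong₂ (λ x y → α * (s * x * dM) + β * (s * y * dN))
                    (M≈P zero j j≢q) (N≈P zero j j≢q)) ⟩
    α * laplaceTerm M j + β * laplaceTerm N j          ∎
    where
    open ≡-Reasoning
    s = sign (toℕ j)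
    dM = det n (minor₀ M j)
    dN = det n (minor₀ N j)
    ih : det n (minor₀ P j) ≡ α * dM + β * dN
    ih = det-linear-column n (punchOut j≢q) α β
           (λ a b b≢ → M≈P (suc a) (punchIn j b) (punchIn≢ j≢q b≢))
           (λ a b b≢ → N≈P (suc a) (punchIn j b) (punchIn≢ j≢q b≢))
           (λ a → subst (λ c → P (suc a) c ≡ α * M (suc a) c + β * N (suc a) c)
                        (sym (punchIn-punchOut j≢q)) (Pq (suc a)))
    distrib : ∀ s p α β x y → s * p * (α * x + β * y) ≡ α * (s * p * x) + β * (s * p * y)
    distrib = solve-∀

det-additive-row : ∀ n {M N P : Mat n n} x →
                (∀ a b → a ≢ x → M a b ≡ P a b) → (∀ a b → a ≢ x → N a b ≡ P a b) →
                (∀ b → P x b ≡ M x b + N x b) → det n P ≡ det n M + det n N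
det-additive-row (suc n) {M} {N} {P} x M≈P N≈P Px =
  trans (det-by-terms P (term x M≈P N≈P Px))
    (trans (∑-distrib-+ (laplaceTerm M) (laplaceTerm N))
      (sym (cong₂ _+_ (det-laplace M) (det-laplace N))))
  where
  term : ∀ x → (∀ a b → a ≢ x → M a b ≡ P a b) → (∀ a b → a ≢ x → N a b ≡ P a b) →
         (∀ b → P x b ≡ M x b + N x b) → ∀ j → laplaceTerm P j ≡ laplaceTerm M j + laplaceTerm N j
  term zero M≈P N≈P Px j = begin
    s * P zero j * dP                          ≡⟨ cong (λ y → s * y * dP) (Px j) ⟩
    s * (M zero j + N zero j) * dP             ≡⟨ distrib s (M zero j) (N zero j) dP ⟩
    s * M zero j * dP + s * N zero j * dP
      ≡⟨ sym (cong₂ (λ y z → s * M zero j * y + s * N zero j * z) (minor≡ M≈P) (minor≡ N≈P)) ⟩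
    laplaceTerm M j + laplaceTerm N j          ∎
    where
    open ≡-Reasoning
    s = sign (toℕ j)
    dP = det n (minor₀ P j)
    minor≡ : ∀ {K : Mat (suc n) (suc n)} → (∀ a b → a ≢ zero → K a b ≡ P a b) →
             det n (minor₀ K j) ≡ dP
    minor≡ K≈P = det-cong n (λ a b → K≈P (suc a) (punchIn j b) (λ ()))
    distrib : ∀ s m n d → s * (m + n) * d ≡ s * m * d + s * n * d
    distrib = solve-∀
  term (suc x) M≈P N≈P Px j = begin
    s * P zero j * det n (minor₀ P j)          ≡⟨ cong (s * P zero j *_) ih ⟩
    s * P zero j * (dM + dN)                   ≡⟨ ℤP.*-distribˡ-+ (s * P zero j) dM dN ⟩
    s * P zero j * dM + s * P zero j * dN
      ≡⟨ sym (cong₂ (λ y z → s * y * dM + s * z * dN) (M≈P zero j (λ ())) (N≈P zero j (λ ()))) ⟩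
    laplaceTerm M j + laplaceTerm N j          ∎
    where
    open ≡-Reasoning
    s = sign (toℕ j)
    dM = det n (minor₀ M j)
    dN = det n (minor₀ N j)
    ih : det n (minor₀ P j) ≡ dM + dN
    ih = det-additive-row n x (λ a b a≢x → M≈P (suc a) (punchIn j b) (a≢x ∘ suc-injective))
                          (λ a b a≢x → N≈P (suc a) (punchIn j b) (a≢x ∘ suc-injective))
                          (λ b → Px (punchIn j b))

permuteColumns : ∀ {n} → Mat n n → (Fin n → Fin n) → Mat n n
permuteColumns M π a b = M a (π b)

-- The transposition matches the Laplace terms of M′ with those of M up to sign: at p and q the
-- minors coincide and the signs differ, elsewhere the minors differ by an adjacent swap.
det-swap-adjacent : ∀ n (M : Mat n n) {p q} → Adjacent p q →
                    det n (permuteColumns M (transpose p q)) ≡ - det n M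
det-swap-adjacent (suc n) M {p} {q} adj = begin
  det (suc n) M′                                  ≡⟨ det-by-terms M′ (λ j → term j (j ≟ p) (j ≟ q)) ⟩
  sum (λ j → - laplaceTerm M (transpose p q j))   ≡⟨ sum-neg (laplaceTerm M ∘ transpose p q) ⟩
  - sum (laplaceTerm M ∘ transpose p q)           ≡⟨ cong -_ (sym (sum-permute (laplaceTerm M) (Perm.transpose p q))) ⟩
  - sum (laplaceTerm M)                           ≡⟨ cong -_ (sym (det-laplace M)) ⟩
  - det (suc n) M                                 ∎
  where
  open ≡-Reasoning
  M′ = permuteColumns M (transpose p q)
  sign-q : sign (toℕ q) ≡ - sign (toℕ p)
  sign-q = trans (cong sign adj) (sign-suc (toℕ p))
  flip₁ : ∀ s m d → s * m * d ≡ - (- s * m * d)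
  flip₁ = solve-∀
  flip₂ : ∀ s m d → - s * m * d ≡ - (s * m * d)
  flip₂ = solve-∀
  flip₃ : ∀ s m d → s * m * - d ≡ - (s * m * d)
  flip₃ = solve-∀
  term : ∀ j → Dec (j ≡ p) → Dec (j ≡ q) → laplaceTerm M′ j ≡ - laplaceTerm M (transpose p q j)
  term j (yes refl) _ = begin
    sign (toℕ j) * M zero (transpose j q j) * det n (minor₀ M′ j)
      ≡⟨ cong₂ (λ m d → sign (toℕ j) * M zero m * d) (transpose-matchˡ j q)
               (det-cong n (λ a b → cong (M (suc a)) (transpose-punchInˡ adj b))) ⟩
    sign (toℕ j) * M zero q * det n (minor₀ M q)
      ≡⟨ flip₁ (sign (toℕ j)) (M zero q) (det n (minor₀ M q)) ⟩
    - (- sign (toℕ j) * M zero q * det n (minor₀ M q))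
      ≡⟨ cong (λ s → - (s * M zero q * det n (minor₀ M q))) (sym sign-q) ⟩
    - laplaceTerm M q
      ≡⟨ cong (-_ ∘ laplaceTerm M) (sym (transpose-matchˡ j q)) ⟩
    - laplaceTerm M (transpose j q j) ∎
  term j (no _) (yes refl) = begin
    sign (toℕ j) * M zero (transpose p j j) * det n (minor₀ M′ j)
      ≡⟨ cong₂ (λ m d → sign (toℕ j) * M zero m * d) (transpose-matchʳ p j)
               (det-cong n (λ a b → cong (M (suc a)) (transpose-punchInʳ adj b))) ⟩
    sign (toℕ j) * M zero p * det n (minor₀ M p)
      ≡⟨ cong (λ s → s * M zero p * det n (minor₀ M p)) sign-q ⟩
    - sign (toℕ p) * M zero p * det n (minor₀ M p)
      ≡⟨ flip₂ (sign (toℕ p)) (M zero p) (det n (minor₀ M p)) ⟩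
    - laplaceTerm M p
      ≡⟨ cong (-_ ∘ laplaceTerm M) (sym (transpose-matchʳ p j)) ⟩
    - laplaceTerm M (transpose p j j) ∎
  term j (no j≢p) (no j≢q) with adjacent-punchOut j p q adj j≢p j≢q
  ... | p′ , q′ , refl , refl , adj′ = begin
    sign (toℕ j) * M zero (transpose p q j) * det n (minor₀ M′ j)
      ≡⟨ cong₂ (λ m d → sign (toℕ j) * M zero m * d) (transpose-other j≢p j≢q)
               (det-cong n (λ a b → cong (M (suc a)) (sym (punchIn-transpose′ b)))) ⟩
    sign (toℕ j) * M zero j * det n (permuteColumns (minor₀ M j) (transpose p′ q′))
      ≡⟨ cong (sign (toℕ j) * M zero j *_) (det-swap-adjacent n (minor₀ M j) adj′) ⟩
    sign (toℕ j) * M zero j * - det n (minor₀ M j)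
      ≡⟨ flip₃ (sign (toℕ j)) (M zero j) (det n (minor₀ M j)) ⟩
    - laplaceTerm M j
      ≡⟨ cong (-_ ∘ laplaceTerm M) (sym (transpose-other j≢p j≢q)) ⟩
    - laplaceTerm M (transpose p q j) ∎
    where
    punchIn-transpose′ : ∀ b → punchIn j (transpose p′ q′ b) ≡ transpose p q (punchIn j b)
    punchIn-transpose′ b = punchIn-transpose j p′ q′ b (b ≟ p′) (b ≟ q′)

det-equal-adjacent-columns : ∀ n (M : Mat n n) {p q} → Adjacent p q → (∀ a → M a p ≡ M a q) →
                             det n M ≡ 0ℤ
det-equal-adjacent-columns n M {p} {q} adj p≈q = i≡-i⇒i≡0 (begin
  det n M                                  ≡⟨ det-cong n (λ a b → swap-invisible a b (b ≟ p) (b ≟ q)) ⟩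
  det n (permuteColumns M (transpose p q)) ≡⟨ det-swap-adjacent n M adj ⟩
  - det n M                                ∎)
  where
  open ≡-Reasoning
  swap-invisible : ∀ a b → Dec (b ≡ p) → Dec (b ≡ q) → M a b ≡ M a (transpose p q b)
  swap-invisible a b (yes refl) _ = trans (p≈q a) (cong (M a) (sym (transpose-matchˡ p q)))
  swap-invisible a b (no _) (yes refl) = trans (sym (p≈q a)) (cong (M a) (sym (transpose-matchʳ p q)))
  swap-invisible a b (no b≢p) (no b≢q) = cong (M a) (sym (transpose-other b≢p b≢q))

-- Swapping q with its left neighbour brings the two equal columns one step closer.
det-equal-columns-at-distance : ∀ d n (M : Mat n n) {p q} → toℕ q ≡ suc (d ℕ.+ toℕ p) →
                                (∀ a → M a p ≡ M a q) → det n M ≡ 0ℤ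
det-equal-columns-at-distance zero n M adj p≈q = det-equal-adjacent-columns n M adj p≈q
det-equal-columns-at-distance (suc d) (suc n) M {p} {suc q₀} dist p≈q = begin
  det (suc n) M                         ≡⟨ sym (ℤP.neg-involutive _) ⟩
  - - det (suc n) M                     ≡⟨ cong -_ (sym (det-swap-adjacent (suc n) M adj)) ⟩
  - det (suc n) M′                      ≡⟨ cong -_ (det-equal-columns-at-distance d (suc n) M′ dist′ p≈q₁) ⟩
  - 0ℤ                                  ∎
  where
  open ≡-Reasoning
  q₁ = Fin.inject₁ q₀
  q = suc q₀
  adj : Adjacent q₁ q
  adj = cong suc (sym (toℕ-inject₁ q₀))
  M′ = permuteColumns M (transpose q₁ q)
  dist′ : toℕ q₁ ≡ suc (d ℕ.+ toℕ p)
  dist′ = trans (toℕ-inject₁ q₀) (ℕP.suc-injective dist)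
  far : ∀ {q′ d′} → toℕ q′ ≡ suc (d′ ℕ.+ toℕ p) → p ≢ q′
  far q′-dist p≡q′ = ℕP.m≢1+n+m (toℕ p) (trans (cong toℕ p≡q′) q′-dist)
  p≈q₁ : ∀ a → M′ a p ≡ M′ a q₁
  p≈q₁ a = begin
    M a (transpose q₁ q p)   ≡⟨ cong (M a) (transpose-other (far dist′) (far dist)) ⟩
    M a p                    ≡⟨ p≈q a ⟩
    M a q                    ≡⟨ cong (M a) (sym (transpose-matchˡ q₁ q)) ⟩
    M a (transpose q₁ q q₁)  ∎

det-equal-columns : ∀ n (M : Mat n n) {p q} → p ≢ q → (∀ a → M a p ≡ M a q) → det n M ≡ 0ℤ
det-equal-columns n M {p} {q} p≢q p≈q with ℕP.<-cmp (toℕ p) (toℕ q)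
... | tri< p<q _ _ = let d , p+d≡q = ℕP.m≤n⇒∃[o]m+o≡n p<q in
  det-equal-columns-at-distance d n M (trans (sym p+d≡q) (cong suc (ℕP.+-comm (toℕ p) d))) p≈q
... | tri≈ _ p≡q _ = ⊥-elim (p≢q (toℕ-injective p≡q))
... | tri> _ _ q<p = let d , q+d≡p = ℕP.m≤n⇒∃[o]m+o≡n q<p in
  det-equal-columns-at-distance d n M (trans (sym q+d≡p) (cong suc (ℕP.+-comm (toℕ q) d))) (sym ∘ p≈q)

det-add-column-multiple : ∀ n {M M′ : Mat n n} {p q} (c : ℤ) → p ≢ q →
                          (∀ a b → b ≢ q → M a b ≡ M′ a b) → (∀ a → M′ a q ≡ M a q + c * M a p) →
                          det n M′ ≡ det n M
det-add-column-multiple n {M} {M′} {p} {q} c p≢q M≈M′ M′q = begin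
  det n M′
    ≡⟨ det-linear-column n q 1ℤ c M≈M′ N≈M′ (λ a → trans (M′q a) (sym (combination a))) ⟩
  1ℤ * det n M + c * det n N
    ≡⟨ cong (λ x → 1ℤ * det n M + c * x) (det-equal-columns n N p≢q N-p≈q) ⟩
  1ℤ * det n M + c * 0ℤ         ≡⟨ simplify (det n M) c ⟩
  det n M                       ∎
  where
  open ≡-Reasoning
  N : Mat n n
  N a = updateAt (M a) q (const (M a p))
  N≈M′ : ∀ a b → b ≢ q → N a b ≡ M′ a b
  N≈M′ a b b≢q = trans (updateAt-minimal b q (M a) b≢q) (M≈M′ a b b≢q)
  N-p≈q : ∀ a → N a p ≡ N a q
  N-p≈q a = trans (updateAt-minimal p q (M a) p≢q) (sym (updateAt-updates q (M a)))
  combination : ∀ a → 1ℤ * M a q + c * N a q ≡ M a q + c * M a p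
  combination a = cong₂ (λ x y → x + c * y) (ℤP.*-identityˡ (M a q)) (updateAt-updates q (M a))
  simplify : ∀ d c → 1ℤ * d + c * 0ℤ ≡ d
  simplify = solve-∀

addColumnMultiples : ∀ {n} → Mat n n → Fin n → (Fin n → ℤ) → Mat n n
addColumnMultiples M p c a b = M a b + c b * M a p

-- Induction on a bound k of the support of c: dropping column k from it is one column operation.
det-add-column-multiples : ∀ n (M : Mat n n) p (c : Fin n → ℤ) → c p ≡ 0ℤ →
                           det n (addColumnMultiples M p c) ≡ det n M
det-add-column-multiples n M p c cp≡0 =
  go n ℕP.≤-refl c cp≡0 (λ b n≤b → ⊥-elim (ℕP.<⇒≱ (toℕ<n b) n≤b))
  where
  unchanged : ∀ (c : Fin n → ℤ) a b → c b ≡ 0ℤ → addColumnMultiples M p c a b ≡ M a b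
  unchanged c a b cb≡0 = trans (cong (λ x → M a b + x * M a p) cb≡0) (ℤP.+-identityʳ (M a b))
  go : ∀ k → k ≤ n → ∀ c → c p ≡ 0ℤ → (∀ b → k ≤ toℕ b → c b ≡ 0ℤ) →
       det n (addColumnMultiples M p c) ≡ det n M
  go zero    _   c _     supported = det-cong n (λ a b → unchanged c a b (supported b z≤n))
  go (suc k) k<n c cp≡0 supported = trans step (go k (ℕP.<⇒≤ k<n) c′ c′p≡0 supported′)
    where
    q = Fin.fromℕ< k<n
    c′ = updateAt c q (const 0ℤ)
    c′p≡0 : c′ p ≡ 0ℤ
    c′p≡0 with p ≟ q
    ... | yes refl = updateAt-updates q c
    ... | no p≢q   = trans (updateAt-minimal p q c p≢q) cp≡0
    supported′ : ∀ b → k ≤ toℕ b → c′ b ≡ 0ℤ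
    supported′ b k≤b with b ≟ q
    ... | yes refl = updateAt-updates q c
    ... | no b≢q   = trans (updateAt-minimal b q c b≢q) (supported b (ℕP.≤∧≢⇒< k≤b k≢b))
      where
      k≢b : k ≢ toℕ b
      k≢b k≡b = b≢q (toℕ-injective (trans (sym k≡b) (sym (toℕ-fromℕ< k<n))))
    step : det n (addColumnMultiples M p c) ≡ det n (addColumnMultiples M p c′)
    step with q ≟ p
    ... | yes refl = det-cong n (λ a b → cong (λ x → M a b + x * M a q) (c≗c′ b (b ≟ q)))
      where
      c≗c′ : ∀ b → Dec (b ≡ q) → c b ≡ c′ b
      c≗c′ b (yes refl) = trans cp≡0 (sym (updateAt-updates q c))
      c≗c′ b (no b≢q)   = sym (updateAt-minimal b q c b≢q)
    ... | no q≢p = det-add-column-multiple n (c q) (q≢p ∘ sym)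
      (λ a b b≢q → cong (λ x → M a b + x * M a p) (updateAt-minimal b q c b≢q))
      (λ a → cong₂ (λ x y → x + c q * y) (sym (unchanged c′ a q (updateAt-updates q c)))
                                          (sym (unchanged c′ a p c′p≡0)))

column : ∀ {m n} → (Fin m → Fin n → ℤ) → Fin n → Fin m → ℤ
column M b a = M a b

≡0⇒∣∣≤ : ∀ {x} k → x ≡ 0ℤ → ∣ x ∣ ≤ k
≡0⇒∣∣≤ k refl = z≤n

replaceRow : ∀ {n} → Mat n n → Fin n → (Fin n → ℤ) → Mat n n
replaceRow M x r = updateAt M x (const r)

module _ {n} {M : Mat n n} {x : Fin n} {r : Fin n → ℤ} where

  replaceRow-at : ∀ b → replaceRow M x r x b ≡ r b
  replaceRow-at b = cong (λ row → row b) (updateAt-updates x M)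

  replaceRow-off : ∀ {a} b → a ≢ x → replaceRow M x r a b ≡ M a b
  replaceRow-off {a} b a≢x = cong (λ row → row b) (updateAt-minimal a x M a≢x)

replaceRow-twice : ∀ {n} {M : Mat n n} {x r} r′ a b →
                   replaceRow (replaceRow M x r) x r′ a b ≡ replaceRow M x r′ a b
replaceRow-twice {M = M} {x} {r} r′ a b with a ≟ x
... | yes refl = trans (replaceRow-at b) (sym (replaceRow-at b))
... | no a≢x   = trans (replaceRow-off {M = replaceRow M x r} b a≢x)
                       (trans (replaceRow-off b a≢x) (sym (replaceRow-off b a≢x)))

replaceRow-column : ∀ {n} (M : Mat n n) x r a b → replaceRow M x r a b ≡ updateAt (column M b) x (const (r b)) a
replaceRow-column M x r a b with a ≟ x
... | yes refl = trans (replaceRow-at b) (sym (updateAt-updates a (column M b)))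
... | no a≢x   = trans (replaceRow-off b a≢x) (sym (updateAt-minimal a x (column M b) a≢x))

det-row-split-bound : ∀ n (M : Mat n n) x (r₁ r₂ : Fin n → ℤ) {k₁ k₂} → (∀ b → M x b ≡ r₁ b + r₂ b) →
                      ∣ det n (replaceRow M x r₁) ∣ ≤ k₁ → ∣ det n (replaceRow M x r₂) ∣ ≤ k₂ →
                      ∣ det n M ∣ ≤ k₁ ℕ.+ k₂
det-row-split-bound n M x r₁ r₂ split bound₁ bound₂ = begin
  ∣ det n M ∣                     ≡⟨ cong ∣_∣ (det-additive-row n x (λ a b → replaceRow-off b)
                                                                  (λ a b → replaceRow-off b) split′) ⟩
  ∣ det n M₁ + det n M₂ ∣         ≤⟨ ℤP.∣i+j∣≤∣i∣+∣j∣ (det n M₁) (det n M₂) ⟩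
  ∣ det n M₁ ∣ ℕ.+ ∣ det n M₂ ∣   ≤⟨ ℕP.+-mono-≤ bound₁ bound₂ ⟩
  _                               ∎
  where
  open ℕP.≤-Reasoning
  M₁ = replaceRow M x r₁
  M₂ = replaceRow M x r₂
  split′ : ∀ b → M x b ≡ M₁ x b + M₂ x b
  split′ b = trans (split b) (sym (cong₂ _+_ (replaceRow-at b) (replaceRow-at b)))

det-row-sum-bound : ∀ k n (M : Mat n n) x (F : Fin k → Fin n → ℤ) (c : Fin k → ℕ) →
                    (∀ b → M x b ≡ sum (λ i → F i b)) →
                    (∀ i → ∣ det n (replaceRow M x (F i)) ∣ ≤ c i) → ∣ det n M ∣ ≤ sumℕ c
det-row-sum-bound zero n M x F c row bound = ≡0⇒∣∣≤ 0 (det-zero-row n M x row)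
det-row-sum-bound (suc k) n M x F c row bound =
  det-row-split-bound n M x (F zero) (λ b → sum (λ i → F (suc i) b)) row (bound zero)
    (det-row-sum-bound k n _ x (F ∘ suc) (c ∘ suc) replaceRow-at
      (λ i → subst (_≤ c (suc i)) (cong ∣_∣ (sym (det-cong n (replaceRow-twice (F (suc i))))))
                   (bound (suc i))))

-- Incidence vectors

IsTrit : ℤ → Set
IsTrit z = z ≡ 0ℤ ⊎ z ≡ 1ℤ ⊎ z ≡ -1ℤ

IsUnit : ℤ → Set
IsUnit z = z ≡ 1ℤ ⊎ z ≡ -1ℤ

unit² : ∀ {s} → IsUnit s → s * s ≡ 1ℤ
unit² (inj₁ refl) = refl
unit² (inj₂ refl) = refl

unit≢0 : ∀ {s} → IsUnit s → s ≢ 0ℤ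
unit≢0 (inj₁ refl) ()
unit≢0 (inj₂ refl) ()

unit-* : ∀ {a b} → IsUnit a → IsUnit b → IsUnit (a * b)
unit-* (inj₁ refl) (inj₁ refl) = inj₁ refl
unit-* (inj₁ refl) (inj₂ refl) = inj₂ refl
unit-* (inj₂ refl) (inj₁ refl) = inj₂ refl
unit-* (inj₂ refl) (inj₂ refl) = inj₁ refl

∣unit∣ : ∀ {s} → IsUnit s → ∣ s ∣ ≡ 1
∣unit∣ (inj₁ refl) = refl
∣unit∣ (inj₂ refl) = refl

-- A column of the incidence matrix of a directed graph whose arcs may lack a head or a tail.
record IsIncidence {n} (v : Fin n → ℤ) : Set where
  field
    entry    : ∀ t → IsTrit (v t)
    unique-1 : ∀ {s t} → v s ≡ 1ℤ → v t ≡ 1ℤ → s ≡ t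
    unique-¯1 : ∀ {s t} → v s ≡ -1ℤ → v t ≡ -1ℤ → s ≡ t

open IsIncidence

IsIncidence-unit : ∀ {n} {v : Fin n → ℤ} {x} → IsIncidence v → v x ≢ 0ℤ → IsUnit (v x)
IsIncidence-unit {x = x} inc vx≢0 with inc .entry x
... | inj₁ vx≡0 = ⊥-elim (vx≢0 vx≡0)
... | inj₂ unit = unit

IsIncidence-cong : ∀ {n} {v w : Fin n → ℤ} → (∀ t → v t ≡ w t) → IsIncidence v → IsIncidence w
IsIncidence-cong v≗w inc .entry t = subst IsTrit (v≗w t) (inc .entry t)
IsIncidence-cong v≗w inc .unique-1 ws≡1 wt≡1 = inc .unique-1 (trans (v≗w _) ws≡1) (trans (v≗w _) wt≡1)
IsIncidence-cong v≗w inc .unique-¯1 ws≡¯1 wt≡¯1 = inc .unique-¯1 (trans (v≗w _) ws≡¯1) (trans (v≗w _) wt≡¯1)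

IsIncidence-∘ : ∀ {k n} {v : Fin n → ℤ} {ρ : Fin k → Fin n} → Injective _≡_ _≡_ ρ →
                IsIncidence v → IsIncidence (v ∘ ρ)
IsIncidence-∘ {ρ = ρ} ρ-inj inc .entry t = inc .entry (ρ t)
IsIncidence-∘ ρ-inj inc .unique-1 vs≡1 vt≡1 = ρ-inj (inc .unique-1 vs≡1 vt≡1)
IsIncidence-∘ ρ-inj inc .unique-¯1 vs≡¯1 vt≡¯1 = ρ-inj (inc .unique-¯1 vs≡¯1 vt≡¯1)

IsIncidence-neg : ∀ {n} {v : Fin n → ℤ} → IsIncidence v → IsIncidence (λ t → - v t)
IsIncidence-neg {v = v} inc .entry t with inc .entry t
... | inj₁ vt≡0         = inj₁ (cong -_ vt≡0)
... | inj₂ (inj₁ vt≡1)  = inj₂ (inj₂ (cong -_ vt≡1))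
... | inj₂ (inj₂ vt≡¯1) = inj₂ (inj₁ (cong -_ vt≡¯1))
IsIncidence-neg inc .unique-1 vs≡1 vt≡1 = inc .unique-¯1 (ℤP.neg-injective vs≡1) (ℤP.neg-injective vt≡1)
IsIncidence-neg inc .unique-¯1 vs≡¯1 vt≡¯1 = inc .unique-1 (ℤP.neg-injective vs≡¯1) (ℤP.neg-injective vt≡¯1)

IsIncidence-scale : ∀ {n} {v : Fin n → ℤ} {s} → IsUnit s → IsIncidence v → IsIncidence (λ t → s * v t)
IsIncidence-scale (inj₁ refl) inc = IsIncidence-cong (λ t → sym (ℤP.*-identityˡ _)) inc
IsIncidence-scale (inj₂ refl) inc = IsIncidence-cong (λ t → sym (ℤP.-1*i≡-i _)) (IsIncidence-neg inc)

zeroAt : ∀ {n} → Fin n → (Fin n → ℤ) → Fin n → ℤ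
zeroAt x v = updateAt v x (const 0ℤ)

IsIncidence-zeroAt : ∀ {n} {v : Fin n → ℤ} x → IsIncidence v → IsIncidence (zeroAt x v)
IsIncidence-zeroAt {v = v} x inc = record
  { entry    = λ t → entry′ t (t ≟ x)
  ; unique-1 = λ {s} {t} v′s≡1 v′t≡1 →
      inc .unique-1 (kept s (s ≟ x) (λ ()) v′s≡1) (kept t (t ≟ x) (λ ()) v′t≡1)
  ; unique-¯1 = λ {s} {t} v′s≡¯1 v′t≡¯1 →
      inc .unique-¯1 (kept s (s ≟ x) (λ ()) v′s≡¯1) (kept t (t ≟ x) (λ ()) v′t≡¯1)
  }
  where
  v′ = zeroAt x v
  entry′ : ∀ t → Dec (t ≡ x) → IsTrit (v′ t)
  entry′ t (yes refl) = inj₁ (updateAt-updates x v)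
  entry′ t (no t≢x)   = subst IsTrit (sym (updateAt-minimal t x v t≢x)) (inc .entry t)
  kept : ∀ t → Dec (t ≡ x) → ∀ {z} → z ≢ 0ℤ → v′ t ≡ z → v t ≡ z
  kept t (yes refl) z≢0 v′t≡z = ⊥-elim (z≢0 (trans (sym v′t≡z) (updateAt-updates x v)))
  kept t (no t≢x)   _   v′t≡z = trans (sym (updateAt-minimal t x v t≢x)) v′t≡z

private
  off-one : ∀ {n} {v : Fin n → ℤ} {x t} → IsIncidence v → v x ≡ 1ℤ → t ≢ x → v t ≡ 0ℤ ⊎ v t ≡ -1ℤ
  off-one {v = v} {x} {t} inc vx≡1 t≢x with inc .entry t
  ... | inj₁ vt≡0         = inj₁ vt≡0
  ... | inj₂ (inj₁ vt≡1)  = ⊥-elim (t≢x (inc .unique-1 vt≡1 vx≡1))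
  ... | inj₂ (inj₂ vt≡¯1) = inj₂ vt≡¯1

  DifferenceEntry : ℤ → ℤ → Set
  DifferenceEntry a b = IsTrit (a - b) × (a - b ≡ 1ℤ → b ≡ -1ℤ) × (a - b ≡ -1ℤ → a ≡ -1ℤ)

  difference-entry : ∀ {a b} → a ≡ 0ℤ ⊎ a ≡ -1ℤ → b ≡ 0ℤ ⊎ b ≡ -1ℤ → DifferenceEntry a b
  difference-entry (inj₁ refl) (inj₁ refl) = inj₁ refl , (λ ()) , (λ ())
  difference-entry (inj₁ refl) (inj₂ refl) = inj₂ (inj₁ refl) , (λ _ → refl) , (λ ())
  difference-entry (inj₂ refl) (inj₁ refl) = inj₂ (inj₂ refl) , (λ ()) , (λ _ → refl)
  difference-entry (inj₂ refl) (inj₂ refl) = inj₁ refl , (λ ()) , (λ ())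

-- Off x both vectors lie in {0, -1}, so a 1 in w - u comes from a -1 of u and a -1 from a -1 of w.
IsIncidence-sub-one : ∀ {n} {u w : Fin n → ℤ} {x} → IsIncidence u → IsIncidence w →
                      u x ≡ 1ℤ → w x ≡ 1ℤ → IsIncidence (λ t → w t - u t)
IsIncidence-sub-one {u = u} {w} {x} inc-u inc-w ux≡1 wx≡1 = record
  { entry    = λ t → proj₁ (diff t (t ≟ x))
  ; unique-1 = λ {s} {t} ds≡1 dt≡1 →
      inc-u .unique-¯1 (proj₁ (proj₂ (diff s (s ≟ x))) ds≡1) (proj₁ (proj₂ (diff t (t ≟ x))) dt≡1)
  ; unique-¯1 = λ {s} {t} ds≡¯1 dt≡¯1 →
      inc-w .unique-¯1 (proj₂ (proj₂ (diff s (s ≟ x))) ds≡¯1) (proj₂ (proj₂ (diff t (t ≟ x))) dt≡¯1)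
  }
  where
  diff : ∀ t → Dec (t ≡ x) → DifferenceEntry (w t) (u t)
  diff t (yes refl) rewrite ux≡1 | wx≡1 = inj₁ refl , (λ ()) , (λ ())
  diff t (no t≢x) = difference-entry (off-one inc-w wx≡1 t≢x) (off-one inc-u ux≡1 t≢x)

-- Scaling by the unit s = u x reduces this to the case u x = w x = 1.
IsIncidence-sub : ∀ {n} {u w : Fin n → ℤ} {x} → IsIncidence u → IsIncidence w →
                  u x ≡ w x → u x ≢ 0ℤ → IsIncidence (λ t → w t - u t)
IsIncidence-sub {u = u} {w} {x} inc-u inc-w ux≡wx ux≢0 =
  IsIncidence-cong unscale
    (IsIncidence-scale s-unit
      (IsIncidence-sub-one (IsIncidence-scale s-unit inc-u) (IsIncidence-scale s-unit inc-w)
                           (unit² s-unit) (trans (cong (s *_) (sym ux≡wx)) (unit² s-unit))))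
  where
  s = u x
  s-unit : IsUnit s
  s-unit = IsIncidence-unit inc-u ux≢0
  unscale : ∀ t → s * (s * w t - s * u t) ≡ w t - u t
  unscale t = begin
    s * (s * w t - s * u t)   ≡⟨ expand s (w t) (u t) ⟩
    s * s * (w t - u t)       ≡⟨ cong (_* (w t - u t)) (unit² s-unit) ⟩
    1ℤ * (w t - u t)          ≡⟨ ℤP.*-identityˡ _ ⟩
    w t - u t                 ∎
    where
    open ≡-Reasoning
    expand : ∀ s a b → s * (s * a - s * b) ≡ s * s * (a - b)
    expand = solve-∀

-- The elimination step with pivot u x = ±1; it clears the entry of w at x.
IsIncidence-eliminate : ∀ {n} {u w : Fin n → ℤ} {x} → IsIncidence u → IsIncidence w → u x ≢ 0ℤ →
                        IsIncidence (λ t → w t + - (w x * u x) * u t)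
IsIncidence-eliminate {u = u} {w} {x} inc-u inc-w ux≢0 with inc-w .entry x
... | inj₁ wx≡0 = IsIncidence-cong (λ t → sym (unchanged t)) inc-w
  where
  unchanged : ∀ t → w t + - (w x * u x) * u t ≡ w t
  unchanged t rewrite wx≡0 = ℤP.+-identityʳ (w t)
... | inj₂ τ-unit = IsIncidence-cong (λ t → sym (rearrange (w t) (w x) (u x) (u t)))
    (IsIncidence-sub inc-τσu inc-w τσu-x (unit≢0 τ-unit ∘ trans (sym τσu-x)))
  where
  σ-unit : IsUnit (u x)
  σ-unit = IsIncidence-unit inc-u ux≢0
  τσ = w x * u x
  inc-τσu : IsIncidence (λ t → τσ * u t)
  inc-τσu = IsIncidence-scale (unit-* τ-unit σ-unit) inc-u
  τσu-x : τσ * u x ≡ w x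
  τσu-x = begin
    w x * u x * u x     ≡⟨ ℤP.*-assoc (w x) (u x) (u x) ⟩
    w x * (u x * u x)   ≡⟨ cong (w x *_) (unit² σ-unit) ⟩
    w x * 1ℤ            ≡⟨ ℤP.*-identityʳ (w x) ⟩
    w x                 ∎
    where open ≡-Reasoning
  rearrange : ∀ a b c d → a + - (b * c) * d ≡ a - b * c * d
  rearrange = solve-∀

e-values : ∀ r i (t : Fin r) → (suc (toℕ t) ≡ i × e r i t ≡ 1ℤ) ⊎ (suc (toℕ t) ≢ i × e r i t ≡ 0ℤ)
e-values r i t with suc (toℕ t) ℕ.≟ i
... | yes t≡i = inj₁ (t≡i , refl)
... | no  t≢i = inj₂ (t≢i , refl)

e-self : ∀ {r} (t : Fin r) → e r (suc (toℕ t)) t ≡ 1ℤ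
e-self {r} t with e-values r (suc (toℕ t)) t
... | inj₁ (_ , et≡1)   = et≡1
... | inj₂ (t≢t , _)    = ⊥-elim (t≢t refl)

e-other : ∀ {r i} (t : Fin r) → suc (toℕ t) ≢ i → e r i t ≡ 0ℤ
e-other {r} {i} t t≢i with e-values r i t
... | inj₁ (t≡i , _)  = ⊥-elim (t≢i t≡i)
... | inj₂ (_ , et≡0) = et≡0

same-index : ∀ {r i} {s t : Fin r} → suc (toℕ s) ≡ i → suc (toℕ t) ≡ i → s ≡ t
same-index s≡i t≡i = toℕ-injective (ℕP.suc-injective (trans s≡i (sym t≡i)))

IsIncidence-e : ∀ r i → IsIncidence (e r i)
IsIncidence-e r i = record
  { entry    = λ t → proj₁ (values t)
  ; unique-1 = λ es≡1 et≡1 → same-index (proj₁ (proj₂ (values _)) es≡1) (proj₁ (proj₂ (values _)) et≡1)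
  ; unique-¯1 = λ es≡¯1 _ → ⊥-elim (proj₂ (proj₂ (values _)) es≡¯1)
  }
  where
  values : ∀ t → IsTrit (e r i t) × (e r i t ≡ 1ℤ → suc (toℕ t) ≡ i) × e r i t ≢ -1ℤ
  values t with e-values r i t
  ... | inj₁ (t≡i , et≡1) rewrite et≡1 = inj₂ (inj₁ refl) , (λ _ → t≡i) , (λ ())
  ... | inj₂ (_ , et≡0)   rewrite et≡0 = inj₁ refl , (λ ()) , (λ ())

IsIncidence-e⊖e : ∀ r {i j} → i ≢ j → IsIncidence (e r i ⊖ e r j)
IsIncidence-e⊖e r {i} {j} i≢j = record
  { entry    = λ t → proj₁ (values t)
  ; unique-1 = λ ds≡1 dt≡1 → same-index (proj₁ (proj₂ (values _)) ds≡1) (proj₁ (proj₂ (values _)) dt≡1)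
  ; unique-¯1 = λ ds≡¯1 dt≡¯1 → same-index (proj₂ (proj₂ (values _)) ds≡¯1) (proj₂ (proj₂ (values _)) dt≡¯1)
  }
  where
  values : ∀ t → IsTrit (e r i t - e r j t) ×
                 (e r i t - e r j t ≡ 1ℤ → suc (toℕ t) ≡ i) × (e r i t - e r j t ≡ -1ℤ → suc (toℕ t) ≡ j)
  values t with e-values r i t | e-values r j t
  ... | inj₁ (t≡i , _)      | inj₁ (t≡j , _)      = ⊥-elim (i≢j (trans (sym t≡i) t≡j))
  ... | inj₁ (t≡i , eᵢt≡1) | inj₂ (_ , eⱼt≡0)   rewrite eᵢt≡1 | eⱼt≡0 =
    inj₂ (inj₁ refl) , (λ _ → t≡i) , (λ ())
  ... | inj₂ (_ , eᵢt≡0)   | inj₁ (t≡j , eⱼt≡1) rewrite eᵢt≡0 | eⱼt≡1 =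
    inj₂ (inj₂ refl) , (λ ()) , (λ _ → t≡j)
  ... | inj₂ (_ , eᵢt≡0)   | inj₂ (_ , eⱼt≡0)   rewrite eᵢt≡0 | eⱼt≡0 =
    inj₁ refl , (λ ()) , (λ ())

eliminated-entry : ∀ {σ} m → IsUnit σ → m + - (m * σ) * σ ≡ 0ℤ
eliminated-entry {σ} m σ-unit = begin
  m + - (m * σ) * σ    ≡⟨ rearrange m σ ⟩
  m - m * (σ * σ)      ≡⟨ cong (λ x → m - m * x) (unit² σ-unit) ⟩
  m - m * 1ℤ           ≡⟨ cong (_-_ m) (ℤP.*-identityʳ m) ⟩
  m - m                ≡⟨ ℤP.+-inverseʳ m ⟩
  0ℤ                   ∎
  where
  open ≡-Reasoning
  rearrange : ∀ m σ → m + - (m * σ) * σ ≡ m - m * (σ * σ)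
  rearrange = solve-∀

-- Pivot on a nonzero entry of the first row: column operations clear the rest of that row
-- and keep every column an incidence vector, and the remaining minor is again of this kind.
det-incidence : ∀ n (M : Mat n n) → (∀ b → IsIncidence (column M b)) → ∣ det n M ∣ ≤ 1
det-incidence zero    M inc = ℕP.≤-refl
det-incidence (suc n) M inc with all? (λ p → M zero p ℤ.≟ 0ℤ)
... | yes row₀≡0 = ≡0⇒∣∣≤ 1 (det-zero-row (suc n) M zero row₀≡0)
... | no row₀≢0 with ¬∀⟶∃¬ (suc n) _ (λ p → M zero p ℤ.≟ 0ℤ) row₀≢0
... | p , M0p≢0 = begin
  ∣ det (suc n) M ∣                      ≡⟨ cong ∣_∣ (sym (det-add-column-multiples (suc n) M p c cp≡0)) ⟩
  ∣ det (suc n) M′ ∣                     ≡⟨ cong ∣_∣ (det-single-entry n M′ p row₀′) ⟩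
  ∣ laplaceTerm M′ p ∣                   ≡⟨ ∣laplaceTerm∣ M′ p ⟩
  ∣ M′ zero p ∣ ℕ.* ∣ det n minor ∣      ≡⟨ cong (λ x → ∣ x ∣ ℕ.* ∣ det n minor ∣) (column-p zero) ⟩
  ∣ σ ∣ ℕ.* ∣ det n minor ∣              ≡⟨ cong (ℕ._* ∣ det n minor ∣) (∣unit∣ σ-unit) ⟩
  1 ℕ.* ∣ det n minor ∣                  ≡⟨ ℕP.*-identityˡ _ ⟩
  ∣ det n minor ∣                        ≤⟨ det-incidence n minor minor-inc ⟩
  1                                      ∎
  where
  open ℕP.≤-Reasoning
  σ = M zero p
  σ-unit : IsUnit σ
  σ-unit = IsIncidence-unit (inc p) M0p≢0
  c : Fin (suc n) → ℤ
  c = updateAt (λ b → - (M zero b * σ)) p (const 0ℤ)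
  cp≡0 : c p ≡ 0ℤ
  cp≡0 = updateAt-updates p _
  M′ = addColumnMultiples M p c
  minor = minor₀ M′ p
  column-p : ∀ a → M′ a p ≡ M a p
  column-p a = trans (cong (λ x → M a p + x * M a p) cp≡0) (ℤP.+-identityʳ (M a p))
  column-b : ∀ {b} → b ≢ p → ∀ a → M′ a b ≡ M a b + - (M zero b * σ) * M a p
  column-b {b} b≢p a = cong (λ x → M a b + x * M a p) (updateAt-minimal _ p _ b≢p)
  row₀′ : ∀ b → b ≢ p → M′ zero b ≡ 0ℤ
  row₀′ b b≢p = trans (column-b b≢p zero) (eliminated-entry (M zero b) σ-unit)
  column-inc : ∀ b → Dec (b ≡ p) → IsIncidence (column M′ b)
  column-inc b (yes refl) = IsIncidence-cong (λ a → sym (column-p a)) (inc p)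
  column-inc b (no b≢p)   = IsIncidence-cong (λ a → sym (column-b b≢p a))
                              (IsIncidence-eliminate (inc p) (inc b) M0p≢0)
  minor-inc : ∀ b → IsIncidence (column minor b)
  minor-inc b = IsIncidence-∘ suc-injective (column-inc (punchIn p b) (punchIn p b ≟ p))

-- Matrices that are incidence matrices off one row

zeroedColumn : ∀ {n} → Mat n n → Fin n → Fin n → Fin n → ℤ
zeroedColumn M x b = zeroAt x (column M b)

module _ {n} (M : Mat n n) {x : Fin n} where

  zeroedColumn-at : ∀ b → zeroedColumn M x b x ≡ 0ℤ
  zeroedColumn-at b = updateAt-updates x (column M b)

  zeroedColumn-off : ∀ b {a} → a ≢ x → zeroedColumn M x b a ≡ M a b
  zeroedColumn-off b {a} a≢x = updateAt-minimal a x (column M b) a≢x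

  zeroedColumn-of-zero : ∀ {b} → M x b ≡ 0ℤ → ∀ a → zeroedColumn M x b a ≡ M a b
  zeroedColumn-of-zero {b} Mxb≡0 a with a ≟ x
  ... | yes refl = trans (zeroedColumn-at b) (sym Mxb≡0)
  ... | no a≢x   = zeroedColumn-off b a≢x

  zeroedColumn-addColumnMultiples : ∀ p c b a →
    zeroedColumn (addColumnMultiples M p c) x b a ≡ zeroedColumn M x b a + c b * zeroedColumn M x p a
  zeroedColumn-addColumnMultiples p c b a with a ≟ x
  ... | yes refl = trans (updateAt-updates x (column (addColumnMultiples M p c) b))
    (sym (trans (cong₂ (λ y z → y + c b * z) (zeroedColumn-at b) (zeroedColumn-at p))
                (trans (ℤP.+-identityˡ (c b * 0ℤ)) (ℤP.*-zeroʳ (c b)))))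
  ... | no a≢x = trans (zeroedColumn-off′ a≢x)
                       (sym (cong₂ (λ y z → y + c b * z) (zeroedColumn-off b a≢x) (zeroedColumn-off p a≢x)))
    where
    zeroedColumn-off′ : a ≢ x → zeroedColumn (addColumnMultiples M p c) x b a ≡ M a b + c b * M a p
    zeroedColumn-off′ = updateAt-minimal a x (column (addColumnMultiples M p c) b)

zeroedColumn-cong : ∀ {n} {M N : Mat n n} {x} → (∀ a b → a ≢ x → M a b ≡ N a b) →
                    ∀ b a → zeroedColumn M x b a ≡ zeroedColumn N x b a
zeroedColumn-cong {M = M} {N} {x} M≈N b a with a ≟ x
... | yes refl = trans (zeroedColumn-at M b) (sym (zeroedColumn-at N b))
... | no a≢x   = trans (zeroedColumn-off M b a≢x) (trans (M≈N a b a≢x) (sym (zeroedColumn-off N b a≢x)))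

record IsIncidenceOffRow {n} (M : Mat n n) (x : Fin n) : Set where
  field
    zeroed     : ∀ b → IsIncidence (zeroedColumn M x b)
    zeroed-sub : ∀ {b b′} → M x b ≢ 0ℤ → M x b′ ≢ 0ℤ →
                 IsIncidence (λ a → zeroedColumn M x b a - zeroedColumn M x b′ a)

open IsIncidenceOffRow

IsIncidenceOffRow-transfer : ∀ {n} {M N : Mat n n} {x} → (∀ a b → a ≢ x → M a b ≡ N a b) →
                             (∀ b → N x b ≢ 0ℤ → M x b ≢ 0ℤ) → IsIncidenceOffRow M x → IsIncidenceOffRow N x
IsIncidenceOffRow-transfer M≈N support off .zeroed b =
  IsIncidence-cong (zeroedColumn-cong M≈N b) (off .zeroed b)
IsIncidenceOffRow-transfer M≈N support off .zeroed-sub {b} {b′} Nxb≢0 Nxb′≢0 =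
  IsIncidence-cong (λ a → cong₂ _-_ (zeroedColumn-cong M≈N b a) (zeroedColumn-cong M≈N b′ a))
                   (off .zeroed-sub (support b Nxb≢0) (support b′ Nxb′≢0))

RowBoundedBy : ∀ {n} → ℕ → Mat n n → Fin n → Set
RowBoundedBy l M x = ∀ b → ∃ λ β → β ≤ l × M x b ≡ + β

det-unit-row : ∀ n (M : Mat n n) x b₀ → M x b₀ ≡ 1ℤ → (∀ b → b ≢ b₀ → M x b ≡ 0ℤ) →
               (∀ b → IsIncidence (zeroedColumn M x b)) → ∣ det n M ∣ ≤ 1
det-unit-row n M x b₀ Mxb₀≡1 row-off zeroed-inc =
  subst (_≤ 1) (cong ∣_∣ (sym det-M≡det-M₁)) (det-incidence n M₁ (λ b → M₁-inc b (b ≟ b₀)))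
  where
  unit = e n (suc (toℕ x))
  M₁ M₂ : Mat n n
  M₁ a = updateAt (M a) b₀ (const (unit a))
  M₂ a = updateAt (M a) b₀ (const (zeroedColumn M x b₀ a))
  split-entry : ∀ a → Dec (a ≡ x) → M a b₀ ≡ 1ℤ * unit a + 1ℤ * zeroedColumn M x b₀ a
  split-entry a (yes refl) =
    trans Mxb₀≡1 (sym (cong₂ (λ u z → 1ℤ * u + 1ℤ * z) (e-self a) (zeroedColumn-at M b₀)))
  split-entry a (no a≢x) =
    sym (trans (cong₂ (λ u z → 1ℤ * u + 1ℤ * z) (e-other a (a≢x ∘ toℕ-injective ∘ ℕP.suc-injective))
                                                  (zeroedColumn-off M b₀ a≢x))
               (trans (ℤP.+-identityˡ (1ℤ * M a b₀)) (ℤP.*-identityˡ (M a b₀))))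
  det-M≡det-M₁ : det n M ≡ det n M₁
  det-M≡det-M₁ = begin
    det n M                      ≡⟨ det-linear-column n b₀ 1ℤ 1ℤ (λ a b b≢b₀ → updateAt-minimal b b₀ (M a) b≢b₀)
                                      (λ a b b≢b₀ → updateAt-minimal b b₀ (M a) b≢b₀)
                                      (λ a → trans (split-entry a (a ≟ x))
                                        (sym (cong₂ (λ u z → 1ℤ * u + 1ℤ * z) (updateAt-updates b₀ (M a))
                                                                             (updateAt-updates b₀ (M a))))) ⟩
    1ℤ * det n M₁ + 1ℤ * det n M₂ ≡⟨ cong (λ d → 1ℤ * det n M₁ + 1ℤ * d)
                                          (det-zero-row n M₂ x (λ b → M₂-row b (b ≟ b₀))) ⟩
    1ℤ * det n M₁ + 1ℤ * 0ℤ       ≡⟨ simplify (det n M₁) ⟩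
    det n M₁                      ∎
    where
    open ≡-Reasoning
    M₂-row : ∀ b → Dec (b ≡ b₀) → M₂ x b ≡ 0ℤ
    M₂-row b (yes refl) = trans (updateAt-updates b (M x)) (zeroedColumn-at M b)
    M₂-row b (no b≢b₀)  = trans (updateAt-minimal b b₀ (M x) b≢b₀) (row-off b b≢b₀)
    simplify : ∀ d → 1ℤ * d + 1ℤ * 0ℤ ≡ d
    simplify = solve-∀
  M₁-inc : ∀ b → Dec (b ≡ b₀) → IsIncidence (column M₁ b)
  M₁-inc b (yes refl) = IsIncidence-cong (λ a → sym (updateAt-updates b (M a))) (IsIncidence-e n _)
  M₁-inc b (no b≢b₀)  = IsIncidence-cong (λ a → trans (zeroedColumn-of-zero M (row-off b b≢b₀) a)
                                                      (sym (updateAt-minimal b b₀ (M a) b≢b₀)))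
                                         (zeroed-inc b)

-- Subtracting the column b₀ of a 1 in row x from the other such columns turns row x into a unit row.
det-01-row : ∀ n (M : Mat n n) x → RowBoundedBy 1 M x → IsIncidenceOffRow M x → ∣ det n M ∣ ≤ 1
det-01-row n M x bounded off with all? (λ b → M x b ℤ.≟ 0ℤ)
... | yes row≡0 = ≡0⇒∣∣≤ 1 (det-zero-row n M x row≡0)
... | no row≢0 with ¬∀⟶∃¬ n _ (λ b → M x b ℤ.≟ 0ℤ) row≢0
... | b₀ , Mxb₀≢0 = subst (_≤ 1) (cong ∣_∣ (det-add-column-multiples n M b₀ c cb₀≡0))
                          (det-unit-row n M′ x b₀ M′xb₀≡1 row-off′ (λ b → zeroed′ b (b ≟ b₀)))
  where
  entry01 : ∀ b → M x b ≡ 0ℤ ⊎ M x b ≡ 1ℤ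
  entry01 b with bounded b
  ... | 0 , _ , Mxb≡0 = inj₁ Mxb≡0
  ... | 1 , _ , Mxb≡1 = inj₂ Mxb≡1
  ... | suc (suc _) , s≤s () , _
  Mxb₀≡1 : M x b₀ ≡ 1ℤ
  Mxb₀≡1 with entry01 b₀
  ... | inj₁ Mxb₀≡0 = ⊥-elim (Mxb₀≢0 Mxb₀≡0)
  ... | inj₂ Mxb₀≡1 = Mxb₀≡1
  c : Fin n → ℤ
  c = updateAt (λ b → - M x b) b₀ (const 0ℤ)
  cb₀≡0 : c b₀ ≡ 0ℤ
  cb₀≡0 = updateAt-updates b₀ _
  M′ = addColumnMultiples M b₀ c
  M′xb₀≡1 : M′ x b₀ ≡ 1ℤ
  M′xb₀≡1 = trans (cong (λ y → M x b₀ + y * M x b₀) cb₀≡0) (trans (ℤP.+-identityʳ (M x b₀)) Mxb₀≡1)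
  row-off′ : ∀ b → b ≢ b₀ → M′ x b ≡ 0ℤ
  row-off′ b b≢b₀ = trans (cong₂ (λ y z → M x b + y * z) (updateAt-minimal b b₀ _ b≢b₀) Mxb₀≡1)
                          (cancel (M x b))
    where
    cancel : ∀ m → m + - m * 1ℤ ≡ 0ℤ
    cancel = solve-∀
  zeroed-unchanged : ∀ {b} → c b ≡ 0ℤ → IsIncidence (zeroedColumn M′ x b)
  zeroed-unchanged {b} cb≡0 = IsIncidence-cong
    (λ a → sym (trans (zeroedColumn-addColumnMultiples M b₀ c b a)
                      (trans (cong (λ y → zeroedColumn M x b a + y * zeroedColumn M x b₀ a) cb≡0)
                             (ℤP.+-identityʳ _))))
    (off .zeroed b)
  zeroed′ : ∀ b → Dec (b ≡ b₀) → IsIncidence (zeroedColumn M′ x b)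
  zeroed′ b (yes refl) = zeroed-unchanged cb₀≡0
  zeroed′ b (no b≢b₀) with entry01 b
  ... | inj₁ Mxb≡0 = zeroed-unchanged (trans (updateAt-minimal b b₀ _ b≢b₀) (cong -_ Mxb≡0))
  ... | inj₂ Mxb≡1 = IsIncidence-cong
    (λ a → sym (trans (zeroedColumn-addColumnMultiples M b₀ c b a)
                      (trans (cong (λ y → zeroedColumn M x b a + y * zeroedColumn M x b₀ a)
                                   (trans (updateAt-minimal b b₀ _ b≢b₀) (cong -_ Mxb≡1)))
                             (minus-one (zeroedColumn M x b a) (zeroedColumn M x b₀ a)))))
    (off .zeroed-sub (λ Mxb≡0 → unit≢0 (inj₁ refl) (trans (sym Mxb≡1) Mxb≡0)) Mxb₀≢0)
    where
    minus-one : ∀ y z → y + -1ℤ * z ≡ y - z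
    minus-one = solve-∀

-- Row x is split as min(β, 1) + (β - 1): a row of 0s and 1s, and a row bounded by one less.
det-bounded-row : ∀ l n (M : Mat n n) x → RowBoundedBy l M x → IsIncidenceOffRow M x → ∣ det n M ∣ ≤ l
det-bounded-row zero n M x bounded off = ≡0⇒∣∣≤ 0 (det-zero-row n M x row≡0)
  where
  row≡0 : ∀ b → M x b ≡ 0ℤ
  row≡0 b with bounded b
  ... | 0 , _ , Mxb≡0 = Mxb≡0
det-bounded-row (suc l) n M x bounded off =
  det-row-split-bound n M x (row (1 ⊓_)) (row (ℕ._∸ 1)) split
    (det-01-row n _ x bounded₁ (off-part (1 ⊓_) refl))
    (det-bounded-row l n _ x bounded₂ (off-part (ℕ._∸ 1) refl))
  where
  open ≡-Reasoning
  β : Fin n → ℕ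
  β b = proj₁ (bounded b)
  row : (ℕ → ℕ) → Fin n → ℤ
  row f b = + f (β b)
  split : ∀ b → M x b ≡ row (1 ⊓_) b + row (ℕ._∸ 1) b
  split b = begin
    M x b                                ≡⟨ proj₂ (proj₂ (bounded b)) ⟩
    + β b                                ≡⟨ cong +_ (sym (ℕP.m⊓n+n∸m≡n 1 (β b))) ⟩
    + (1 ⊓ β b ℕ.+ (β b ℕ.∸ 1))          ≡⟨ ℤP.pos-+ (1 ⊓ β b) (β b ℕ.∸ 1) ⟩
    + (1 ⊓ β b) + + (β b ℕ.∸ 1)          ∎
  bounded₁ : RowBoundedBy 1 (replaceRow M x (row (1 ⊓_))) x
  bounded₁ b = 1 ⊓ β b , ℕP.m⊓n≤m 1 (β b) , replaceRow-at b
  bounded₂ : RowBoundedBy l (replaceRow M x (row (ℕ._∸ 1))) x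
  bounded₂ b = β b ℕ.∸ 1 , ℕP.∸-monoˡ-≤ 1 (proj₁ (proj₂ (bounded b))) , replaceRow-at b
  off-part : ∀ f → f 0 ≡ 0 → IsIncidenceOffRow (replaceRow M x (row f)) x
  off-part f f0≡0 = IsIncidenceOffRow-transfer (λ a b a≢x → sym (replaceRow-off b a≢x)) support off
    where
    support : ∀ b → replaceRow M x (row f) x b ≢ 0ℤ → M x b ≢ 0ℤ
    support b part≢0 Mxb≡0 = part≢0 (begin
      replaceRow M x (row f) x b   ≡⟨ replaceRow-at b ⟩
      + f (β b)                    ≡⟨ cong (+_ ∘ f) (ℤP.+-injective (trans (sym (proj₂ (proj₂ (bounded b)))) Mxb≡0)) ⟩
      + f 0                        ≡⟨ cong +_ f0≡0 ⟩
      0ℤ                           ∎)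

-- Admissible columns

module Admissible {m r : ℕ} (ℓ : Fin m → ℕ) (ι : Fin m → Fin (suc r)) where

  -- With ℓ = λ and ι i the row of e_{i+1}, these are the columns of A(Δ, λ, r): incidence vectors, and
  -- k e₁ + w with k ≤ λᵢ and w an incidence vector vanishing in the first row with its 1 in row i+1.
  data AdmissibleColumn (v : Fin (suc r) → ℤ) : Set where
    incidence : IsIncidence v → AdmissibleColumn v
    lifted    : ∀ i k → k ≤ ℓ i → v zero ≡ + k → IsIncidence (zeroAt zero v) → zeroAt zero v (ι i) ≡ 1ℤ →
                AdmissibleColumn v

  module _ {v : Fin (suc r) → ℤ} where

    topEntry : AdmissibleColumn v → ℤ
    topEntry (incidence _)        = v zero
    topEntry (lifted _ _ _ _ _ _) = 0ℤ

    liftedEntries : AdmissibleColumn v → Fin m → ℤ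
    liftedEntries (incidence _)        = λ _ → 0ℤ
    liftedEntries (lifted i k _ _ _ _) = updateAt (λ _ → 0ℤ) i (const (+ k))

    first-entry-split : ∀ adm → v zero ≡ topEntry adm + sum (liftedEntries adm)
    first-entry-split (incidence _) =
      sym (trans (cong (_+_ (v zero)) (sum-replicate-zero m)) (ℤP.+-identityʳ (v zero)))
    first-entry-split (lifted i k _ v0≡k _ _) = begin
      v zero                                                ≡⟨ v0≡k ⟩
      + k                                                   ≡⟨ sym (updateAt-updates i (λ _ → 0ℤ)) ⟩
      updateAt (λ _ → 0ℤ) i (const (+ k)) i
        ≡⟨ sym (sum-single _ i (λ i′ i′≢i → updateAt-minimal i′ i _ i′≢i)) ⟩
      sum (updateAt (λ _ → 0ℤ) i (const (+ k)))             ≡⟨ sym (ℤP.+-identityˡ _) ⟩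
      0ℤ + sum (updateAt (λ _ → 0ℤ) i (const (+ k)))        ∎
      where open ≡-Reasoning

    IsIncidence-zeroAt-first : AdmissibleColumn v → IsIncidence (zeroAt zero v)
    IsIncidence-zeroAt-first (incidence inc)        = IsIncidence-zeroAt zero inc
    IsIncidence-zeroAt-first (lifted _ _ _ _ inc _) = inc

    IsIncidence-topEntry : ∀ adm → IsIncidence (updateAt v zero (const (topEntry adm)))
    IsIncidence-topEntry (incidence inc) = IsIncidence-cong unchanged inc
      where
      unchanged : ∀ t → v t ≡ updateAt v zero (const (v zero)) t
      unchanged zero    = refl
      unchanged (suc t) = refl
    IsIncidence-topEntry (lifted _ _ _ _ inc _) = inc

    liftedEntries-bounded : ∀ adm i → ∃ λ β → β ≤ ℓ i × liftedEntries adm i ≡ + β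
    liftedEntries-bounded (incidence _) i = 0 , z≤n , refl
    liftedEntries-bounded (lifted i′ k k≤ℓ _ _ _) i with i ≟ i′
    ... | yes refl = k , k≤ℓ , updateAt-updates i (λ _ → 0ℤ)
    ... | no i≢i′  = 0 , z≤n , updateAt-minimal i i′ (λ _ → 0ℤ) i≢i′

    liftedEntries-nonzero : ∀ adm {i} → liftedEntries adm i ≢ 0ℤ → zeroAt zero v (ι i) ≡ 1ℤ
    liftedEntries-nonzero (incidence _) entry≢0 = ⊥-elim (entry≢0 refl)
    liftedEntries-nonzero (lifted i′ k _ _ _ v′ι≡1) {i} entry≢0 with i ≟ i′
    ... | yes refl = v′ι≡1
    ... | no i≢i′  = ⊥-elim (entry≢0 (updateAt-minimal i i′ (λ _ → 0ℤ) i≢i′))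

  module _ {c} (A : Mat (suc r) c) (admissible : ∀ j → AdmissibleColumn (column A j))
           {k} (μ : Minor (suc r) c k) where

    open Minor μ renaming (rows to ρ; cols to γ)

    private
      M : Mat k k
      M = Sub A ρ γ

      adm : ∀ b → AdmissibleColumn (column A (γ b))
      adm b = admissible (γ b)

      zeroAt-first-restricted : ∀ b → IsIncidence (zeroAt zero (column A (γ b)) ∘ ρ)
      zeroAt-first-restricted b = IsIncidence-∘ rowsInj (IsIncidence-zeroAt-first (adm b))

    det-avoiding-first-row : (∀ a → ρ a ≢ zero) → ∣ minorDet A μ ∣ ≤ 1
    det-avoiding-first-row ρ≢0 = det-incidence k M (λ b →
      IsIncidence-cong (λ a → updateAt-minimal (ρ a) zero _ (ρ≢0 a)) (zeroAt-first-restricted b))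

    module _ {s} (ρs≡0 : ρ s ≡ zero) where

      private
        restricted : ∀ w a b → replaceRow M s w a b ≡ updateAt (column A (γ b)) zero (const (w b)) (ρ a)
        restricted w a b = begin
          replaceRow M s w a b                                     ≡⟨ replaceRow-column M s w a b ⟩
          updateAt (column M b) s (const (w b)) a                  ≡⟨ updateAt-∘ rowsInj s (const (w b)) a ⟩
          updateAt (column A (γ b)) (ρ s) (const (w b)) (ρ a)
            ≡⟨ cong (λ x → updateAt (column A (γ b)) x (const (w b)) (ρ a)) ρs≡0 ⟩
          updateAt (column A (γ b)) zero (const (w b)) (ρ a)       ∎
          where open ≡-Reasoning

      det-topPart : ∣ det k (replaceRow M s (λ b → topEntry (adm b))) ∣ ≤ 1
      det-topPart = det-incidence k _ (λ b → IsIncidence-cong (λ a → sym (restricted _ a b))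
                                        (IsIncidence-∘ rowsInj (IsIncidence-topEntry (adm b))))

      -- Only columns lifted at i meet row s, and all of them have their 1 in row ι i.
      det-liftedPart : ∀ i → ∣ det k (replaceRow M s (λ b → liftedEntries (adm b) i)) ∣ ≤ ℓ i
      det-liftedPart i = det-bounded-row (ℓ i) k M′ s bounded off
        where
        M′ = replaceRow M s (λ b → liftedEntries (adm b) i)
        bounded : RowBoundedBy (ℓ i) M′ s
        bounded b with liftedEntries-bounded (adm b) i
        ... | β , β≤ℓ , entry≡β = β , β≤ℓ , trans (replaceRow-at b) entry≡β
        zeroed-restricted : ∀ b a → zeroAt zero (column A (γ b)) (ρ a) ≡ zeroedColumn M′ s b a
        zeroed-restricted b a = sym (begin
          zeroedColumn M′ s b a                       ≡⟨ zeroedColumn-cong (λ a b a≢s → replaceRow-off b a≢s) b a ⟩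
          zeroedColumn M s b a                        ≡⟨ updateAt-∘ rowsInj s (const 0ℤ) a ⟩
          zeroAt (ρ s) (column A (γ b)) (ρ a)         ≡⟨ cong (λ x → zeroAt x (column A (γ b)) (ρ a)) ρs≡0 ⟩
          zeroAt zero (column A (γ b)) (ρ a)          ∎)
          where open ≡-Reasoning
        one-at-ι : ∀ {b} → M′ s b ≢ 0ℤ → zeroAt zero (column A (γ b)) (ι i) ≡ 1ℤ
        one-at-ι {b} M′sb≢0 = liftedEntries-nonzero (adm b) (M′sb≢0 ∘ trans (replaceRow-at b))
        off : IsIncidenceOffRow M′ s
        off .zeroed b = IsIncidence-cong (zeroed-restricted b) (zeroAt-first-restricted b)
        off .zeroed-sub {b} {b′} M′sb≢0 M′sb′≢0 =
          IsIncidence-cong (λ a → cong₂ _-_ (zeroed-restricted b a) (zeroed-restricted b′ a))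
            (IsIncidence-∘ rowsInj
              (IsIncidence-sub-one {x = ι i} (IsIncidence-zeroAt-first (adm b′)) (IsIncidence-zeroAt-first (adm b))
                                   (one-at-ι M′sb′≢0) (one-at-ι M′sb≢0)))

      det-through-first-row : ∣ minorDet A μ ∣ ≤ suc (sumℕ ℓ)
      det-through-first-row = det-row-sum-bound (suc m) k M s F bound first-row pieces
        where
        F : Fin (suc m) → Fin k → ℤ
        F zero    b = topEntry (adm b)
        F (suc i) b = liftedEntries (adm b) i
        bound : Fin (suc m) → ℕ
        bound zero    = 1
        bound (suc i) = ℓ i
        first-row : ∀ b → M s b ≡ sum (λ i → F i b)
        first-row b = trans (cong (column A (γ b)) ρs≡0) (first-entry-split (adm b))
        pieces : ∀ i → ∣ det k (replaceRow M s (F i)) ∣ ≤ bound i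
        pieces zero    = det-topPart
        pieces (suc i) = det-liftedPart i

  det-admissible : ∀ {c} (A : Mat (suc r) c) → (∀ j → AdmissibleColumn (column A j)) →
                   ∀ {k} (μ : Minor (suc r) c k) → ∣ minorDet A μ ∣ ≤ suc (sumℕ ℓ)
  det-admissible A admissible μ with any? (λ s → Minor.rows μ s ≟ zero)
  ... | yes (s , ρs≡0) = det-through-first-row A admissible μ ρs≡0
  ... | no ρ≢0 = ℕP.≤-trans (det-avoiding-first-row A admissible μ (λ a ρa≡0 → ρ≢0 (a , ρa≡0))) (s≤s z≤n)

-- The columns of A(Δ, λ, r)

all-concatMap : ∀ {A B : Set} {P : B → Set} {f : A → List B} {xs} →
                All (All P ∘ f) xs → All P (concatMap f xs)
all-concatMap = concat⁺ ∘ map⁺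

all-range1 : ∀ {P : ℕ → Set} n → (∀ {k} → k ℕ.< n → P (suc k)) → All P (range1 n)
all-range1 n P-suc = map⁺ (applyUpTo⁺₁ id n P-suc)

all-zip-applyUpTo : ∀ {P : ℕ × ℕ → Set} (f : ℕ → ℕ) λs →
                    (∀ i → P (suc (f (toℕ i)) , List.lookup λs i)) →
                    All P (zip (map suc (applyUpTo f (length λs))) λs)
all-zip-applyUpTo f []       P-at = []
all-zip-applyUpTo f (l ∷ λs) P-at = P-at zero ∷ all-zip-applyUpTo (f ∘ suc) λs (P-at ∘ suc)

sumℕ-lookup : ∀ xs → sumℕ (List.lookup xs) ≡ sumList xs
sumℕ-lookup []       = refl
sumℕ-lookup (x ∷ xs) = cong (x ℕ.+_) (sumℕ-lookup xs)

module ColumnsOfA (λs : List ℕ) (r′ : ℕ) (m≤r′ : length λs ≤ r′) where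

  r = suc r′

  -- Defs.e is 1-based: the part of λ at the 0-based index i belongs to e r (i + 2), in row ι i.
  ι : Fin (length λs) → Fin r
  ι i = suc (Fin.inject≤ i m≤r′)

  open Admissible (List.lookup λs) ι

  toℕ-ι : ∀ i → suc (toℕ (ι i)) ≡ suc (suc (toℕ i))
  toℕ-ι i = cong (λ n → ℕ.suc (ℕ.suc n)) (toℕ-inject≤ i m≤r′)

  e-ι : ∀ i → e r (suc (suc (toℕ i))) (ι i) ≡ 1ℤ
  e-ι i = subst (λ n → e r n (ι i) ≡ 1ℤ) (toℕ-ι i) (e-self (ι i))

  lifted-by : ∀ {v} (w : Fin r → ℤ) i k → k ≤ List.lookup λs i → w zero ≡ 0ℤ → IsIncidence w →
              w (ι i) ≡ 1ℤ → (∀ t → v t ≡ (k · e r 1 ⊕ w) t) → AdmissibleColumn v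
  lifted-by {v} w i k k≤λᵢ w0≡0 inc wι≡1 v≗ =
    lifted i k k≤λᵢ v0≡k (IsIncidence-cong w≗ inc) (trans (sym (w≗ (ι i))) wι≡1)
    where
    v0≡k : v zero ≡ + k
    v0≡k = trans (v≗ zero) (trans (cong₂ _+_ (ℤP.*-identityʳ (+ k)) w0≡0) (ℤP.+-identityʳ (+ k)))
    w≗ : ∀ t → w t ≡ zeroAt zero v t
    w≗ zero    = w0≡0
    w≗ (suc t) = sym (trans (v≗ (suc t)) (trans (cong (_+ w (suc t)) (ℤP.*-zeroʳ (+ k))) (ℤP.+-identityˡ _)))

  differences : ∀ i j → All AdmissibleColumn (if ⌊ i ℕ.<? j ⌋ then (e r i ⊖ e r j) ∷ [] else [])
  differences i j with i ℕ.<? j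
  ... | yes i<j = incidence (IsIncidence-e⊖e r (ℕP.<⇒≢ i<j)) ∷ []
  ... | no _    = []

  lifted-unit : ∀ i k → k ≤ List.lookup λs i → AdmissibleColumn (k · e r 1 ⊕ e r (suc (suc (toℕ i))))
  lifted-unit i k k≤λᵢ = lifted-by (e r (suc (suc (toℕ i)))) i k k≤λᵢ refl (IsIncidence-e r _) (e-ι i) (λ _ → refl)

  lifted-differences : ∀ i k → k ≤ List.lookup λs i → ∀ j →
    All AdmissibleColumn (if ⌊ j ℕ.≟ 1 ⌋ then [] else if ⌊ j ℕ.≟ suc (suc (toℕ i)) ⌋ then []
                          else (k · e r 1 ⊕ e r (suc (suc (toℕ i))) ⊖ e r j) ∷ [])
  lifted-differences i k k≤λᵢ j with j ℕ.≟ 1 | j ℕ.≟ suc (suc (toℕ i))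
  ... | yes _   | _       = []
  ... | no j≢1  | yes _   = []
  ... | no j≢1  | no j≢ιi = lifted-by (e r (suc (suc (toℕ i))) ⊖ e r j) i k k≤λᵢ
          (cong (_-_ 0ℤ) (e-other {r} zero (j≢1 ∘ sym))) (IsIncidence-e⊖e r (j≢ιi ∘ sym))
          (cong₂ _-_ (e-ι i) (e-other (ι i) (λ ιi≡j → j≢ιi (trans (sym ιi≡j) (toℕ-ι i)))))
          (λ t → ℤP.+-assoc ((k · e r 1) t) (e r (suc (suc (toℕ i))) t) (- e r j t)) ∷ []

  all-admissible : All AdmissibleColumn (columnsA λs r)
  all-admissible = ++⁺ units (++⁺ all-differences (++⁺ all-lifted-units all-lifted-differences))
    where
    units = map⁺ (All.universal (λ i → incidence (IsIncidence-e r i)) (range1 r))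
    all-differences = all-concatMap (All.universal (λ i →
      all-concatMap (All.universal (differences i) (range1 r))) (range1 r))
    all-lifted-units = all-concatMap (all-zip-applyUpTo id λs (λ i →
      map⁺ (all-range1 (List.lookup λs i) (λ {k} → lifted-unit i (suc k)))))
    all-lifted-differences = all-concatMap (all-zip-applyUpTo id λs (λ i →
      all-concatMap (all-range1 (List.lookup λs i) (λ {k} k<λᵢ →
        all-concatMap (All.universal (lifted-differences i (suc k) k<λᵢ) (range1 r))))))

proposition4p3 : (Δ : ℕ) → 2 ≤ Δ → (λs : List ℕ) → IsPartition (Δ ∸ 1) λs →
    (r : ℕ) → 1 ≤ r → suc (length λs) ≤ r → IsModular Δ (matA Δ λs r)
proposition4p3 (suc Δ′) _ λs (_ , _ , Σλ≡Δ′) (suc r′) _ (s≤s m≤r′) _ _ μ =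
  subst (λ n → ∣ minorDet (matA (suc Δ′) λs (suc r′)) μ ∣ ≤ suc n)
        (trans (sumℕ-lookup λs) Σλ≡Δ′)
    (det-admissible (matA (suc Δ′) λs (suc r′)) (λ j → All.lookup all-admissible (∈-lookup j)) μ)
  where
  open ColumnsOfA λs r′ m≤r′
  open Admissible (List.lookup λs) ι
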